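{- Let $M$ and $N$ be matroids on disjoint finite sets $S$ and $T$, and let $A\subseteq S$, $B\subseteq T$. The following are equivalent: (1) $T$ is a separator of $(M,N;A,B)$; (2) $(M,N;A,B)=M\oplus N$; (3) either $A$ is a (possibly empty) set of loops of $M$ or $B$ is a (possibly empty) set of coloops of $N$.
   Context: A separator of a matroid $K$ on $E$ is a set $X\subseteq E$ with $r_K(X)+r_K(E-X)=r(K)$ (equivalently, a union of connected components). The principal sum $(M,N;A,B)$ is the matroid union $M^+(A,B)\vee N_0$, where: $N_0=N\oplus U_{0,S}$ ($N$ with the elements of $S$ added as loops); $M^+(A,B)$ is the matroid on $S\cup T$ obtained from $M$ by adding each element of $B$ freely (by successive principal extensions) to the flat $\mathrm{cl}_M(A)$ and each element of $T-B$ as a loop, equivalently the matroid with rank function $r(X\cup Y)=\min\{r_M(X\cup A),\,r_M(X)+|Y\cap B|\}$ for $X\subseteq S$, $Y\subseteq T$; and the matroid union $G\vee H$ of matroids on a common set has as independent sets the unions of an independent set of $G$ and an independent set of $H$. -}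

module Defs where

open import Data.Nat using (ℕ; zero; suc; _+_; _<_; _⊔_; _⊓_)
open import Data.Nat.Properties using (_≟_)
open import Data.Bool using (Bool; true; false; if_then_else_; _∧_)
import Data.Bool.Properties as BoolP
open import Data.Fin using (Fin)
open import Data.Fin.Subset
  using (Subset; inside; outside; _∈_; _∉_; _⊆_; _∪_; _∩_; ∁; ⊤; ⊥; ∣_∣; ⁅_⁆)
open import Data.Fin.Subset.Properties using (_⊆?_)
open import Data.Vec using (Vec; []; _∷_; _++_; take; drop)
open import Data.Vec.Properties using (≡-dec)
open import Data.Product using (Σ; ∃; ∃₂; _×_; _,_; proj₁; proj₂)
open import Data.Sum using (_⊎_)
open import Relation.Nullary using (Dec; yes; no; ¬_; does; _×-dec_)
open import Relation.Unary using (Decidable)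
open import Relation.Binary.PropositionalEquality using (_≡_; refl)

record IndepSystem (n : ℕ) : Set₁ where
  field
    Indep  : Subset n → Set
    indep? : Decidable Indep
open IndepSystem public

record Matroid (n : ℕ) : Set₁ where
  field
    system     : IndepSystem n
    indep-∅    : Indep system ⊥
    indep-⊆    : ∀ {I J} → I ⊆ J → Indep system J → Indep system I
    indep-aug  : ∀ {I J} → Indep system I → Indep system J → ∣ I ∣ < ∣ J ∣ →
                 ∃ λ e → e ∈ J × e ∉ I × Indep system (I ∪ ⁅ e ⁆)
open Matroid public

Ind : ∀ {n} → Matroid n → Subset n → Set
Ind K = Indep (system K)

maxSub : ∀ {n} → (Subset n → ℕ) → ℕ
maxSub {zero}  f = f []
maxSub {suc n} f = maxSub (λ X → f (outside ∷ X)) ⊔ maxSub (λ X → f (inside ∷ X))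

anySub? : ∀ {n} {P : Subset n → Set} → Decidable P → Dec (∃ P)
anySub? {zero}  {P} P? with P? []
... | yes p = yes ([] , p)
... | no ¬p = no λ { ([] , p) → ¬p p }
anySub? {suc n} {P} P? with anySub? {n} {λ X → P (outside ∷ X)} (λ X → P? (outside ∷ X))
... | yes (X , p) = yes (outside ∷ X , p)
... | no ¬o with anySub? {n} {λ X → P (inside ∷ X)} (λ X → P? (inside ∷ X))
...   | yes (X , p) = yes (inside ∷ X , p)
...   | no ¬i = no λ { (outside ∷ X , p) → ¬o (X , p) ; (inside ∷ X , p) → ¬i (X , p) }

rank : ∀ {n} → IndepSystem n → Subset n → ℕ
rank K X = maxSub (λ I → if does (I ⊆? X) ∧ does (indep? K I) then ∣ I ∣ else 0)

rk : ∀ {n} → Matroid n → Subset n → ℕ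
rk K = rank (system K)

IsSeparator : ∀ {n} → IndepSystem n → Subset n → Set
IsSeparator K X = rank K X + rank K (∁ X) ≡ rank K ⊤

-- Two set systems on the same ground set are the same matroid
-- iff they have the same independent sets.
_≐_ : ∀ {n} → IndepSystem n → IndepSystem n → Set
K ≐ L = ∀ I → (Indep K I → Indep L I) × (Indep L I → Indep K I)

IsLoop : ∀ {n} → Matroid n → Fin n → Set
IsLoop K e = ¬ Ind K ⁅ e ⁆

IsBasis : ∀ {n} → Matroid n → Subset n → Set
IsBasis K B = Ind K B × (∀ J → Ind K J → B ⊆ J → J ≡ B)

IsColoop : ∀ {n} → Matroid n → Fin n → Set
IsColoop K e = ∀ B → IsBasis K B → e ∈ B

-- Disjoint union S ⊔ T of ground sets S = Fin s, T = Fin t, realised as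
-- Fin (s + t): a subset of S ∪ T is  X ++ Y  with X ⊆ S, Y ⊆ T.

partS : ∀ s t → Subset (s + t) → Subset s
partS s t Z = take s Z

partT : ∀ s t → Subset (s + t) → Subset t
partT s t Z = drop s Z

Tset : ∀ s t → Subset (s + t)
Tset s t = ⊥ {s} ++ ⊤ {t}

directSum : ∀ {s t} → Matroid s → Matroid t → IndepSystem (s + t)
directSum {s} {t} M N = record
  { Indep  = λ Z → Ind M (partS s t Z) × Ind N (partT s t Z)
  ; indep? = λ Z → indep? (system M) (partS s t Z) ×-dec indep? (system N) (partT s t Z) }

-- N₀ = N ⊕ U_{0,S} : elements of S added as loops
N₀ : ∀ {s t} → Matroid t → IndepSystem (s + t)
N₀ {s} {t} N = record
  { Indep  = λ Z → partS s t Z ≡ ⊥ × Ind N (partT s t Z)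
  ; indep? = λ Z → ≡-dec BoolP._≟_ (partS s t Z) ⊥ ×-dec indep? (system N) (partT s t Z) }

rankPlus : ∀ {s t} → Matroid s → Subset s → Subset t → Subset (s + t) → ℕ
rankPlus {s} {t} M A B Z = rk M (partS s t Z ∪ A) ⊓ (rk M (partS s t Z) + ∣ partT s t Z ∩ B ∣)

MPlus : ∀ {s t} → Matroid s → Subset s → Subset t → IndepSystem (s + t)
MPlus M A B = record
  { Indep  = λ Z → rankPlus M A B Z ≡ ∣ Z ∣
  ; indep? = λ Z → rankPlus M A B Z ≟ ∣ Z ∣ }

_∨_ : ∀ {n} → IndepSystem n → IndepSystem n → IndepSystem n
G ∨ H = record
  { Indep  = λ Z → ∃₂ λ I J → Indep G I × Indep H J × Z ≡ I ∪ J
  ; indep? = λ Z → anySub? (λ I → anySub? (λ J →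
               indep? G I ×-dec (indep? H J ×-dec ≡-dec BoolP._≟_ Z (I ∪ J)))) }

principalSum : ∀ {s t} → Matroid s → Matroid t → Subset s → Subset t → IndepSystem (s + t)
principalSum M N A B = MPlus M A B ∨ N₀ N

module Submission where

-- Write K = (M,N;A,B) = M⁺(A,B) ∨ N₀ and D = M ⊕ N on S ⊔ T, and encode a
-- subset of S ⊔ T as X ++ Y with X ⊆ S, Y ⊆ T.  The proof runs around the
-- cycle (1) ⇒ (3) ⇒ (2) ⇒ (1); the three implications of the theorem are
-- compositions along this cycle.
--   (3) ⇒ (2)  The independent sets of K are the sets X ++ (Y ∪ Y') with
--              X ++ Y independent in M⁺(A,B) and Y' independent in N; there
--              X is independent in M, Y ⊆ B and |X| + |Y| ≤ r_M(X ∪ A).  If A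
--              consists of loops this forces Y = ∅; if B consists of coloops,
--              Y ∪ Y' lies in a basis of N.  Conversely D ⊆ K always.
--   (2) ⇒ (1)  T is a separator of every direct sum M ⊕ N, and separators
--              only depend on the independent sets.
--   (1) ⇒ (3)  If a ∈ A is not a loop, every b ∈ B is freely added to a
--              flat of positive rank, so {b} ∪ B' is independent in K for
--              every basis B' of N.  If b ∉ B', rank counting gives
--              r_K(T) + r_K(S) ≥ |B'| + 1 + r(M) > r(M) + |B'| ≥ r(K).

open import Defs
open import Data.Nat using (ℕ; zero; suc; _+_; _≤_; _⊓_; z≤n; s≤s; s≤s⁻¹)
open import Data.Nat.Properties
open import Data.Bool using (if_then_else_; _∧_; not)
open import Data.Fin using (Fin; zero; suc)
open import Data.Fin.Properties using (any?)
open import Data.Fin.Subset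
  using (Subset; inside; outside; _∈_; _∉_; _⊆_; _∪_; _∩_; ∁; ⊤; ⊥; ∣_∣; ⁅_⁆)
open import Data.Fin.Subset.Properties
open import Data.Vec using ([]; _∷_; _++_; take; drop; here; there)
open import Data.Vec.Properties using (take++drop≡id; map-++; map-replicate)
open import Data.Product using (∃; ∃₂; _×_; _,_; proj₁; proj₂)
open import Data.Sum using (_⊎_; inj₁; inj₂)
open import Relation.Nullary using (Dec; yes; no; ¬_; does; contradiction; _×-dec_)
open import Relation.Unary using (Decidable)
open import Relation.Binary.PropositionalEquality

maxSub-upper : ∀ {n} (f : Subset n → ℕ) X → f X ≤ maxSub f
maxSub-upper {zero}  f []            = ≤-refl
maxSub-upper {suc n} f (outside ∷ X) =
  ≤-trans (maxSub-upper (λ Y → f (outside ∷ Y)) X) (m≤m⊔n _ _)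
maxSub-upper {suc n} f (inside ∷ X)  =
  ≤-trans (maxSub-upper (λ Y → f (inside ∷ Y)) X) (m≤n⊔m _ _)

maxSub-least : ∀ {n} (f : Subset n → ℕ) {k} → (∀ X → f X ≤ k) → maxSub f ≤ k
maxSub-least {zero}  f bound = bound []
maxSub-least {suc n} f bound =
  ⊔-lub (maxSub-least _ (λ X → bound (outside ∷ X)))
        (maxSub-least _ (λ X → bound (inside ∷ X)))

maxSub-attained : ∀ {n} (f : Subset n → ℕ) → ∃ λ X → maxSub f ≡ f X
maxSub-attained {zero}  f = [] , refl
maxSub-attained {suc n} f
  with maxSub-attained (λ Y → f (outside ∷ Y)) | maxSub-attained (λ Y → f (inside ∷ Y))
     | ⊔-sel (maxSub (λ Y → f (outside ∷ Y))) (maxSub (λ Y → f (inside ∷ Y)))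
... | X , eq | _      | inj₁ left  = outside ∷ X , trans left eq
... | _      | X , eq | inj₂ right = inside ∷ X , trans right eq

module _ {n} {P : Subset n → Set} (P? : Decidable P) where

  private
    weight : Subset n → ℕ
    weight X = if does (P? X) then suc ∣ X ∣ else 0

    weight-P : ∀ X → P X → weight X ≡ suc ∣ X ∣
    weight-P X pX with P? X
    ... | yes _  = refl
    ... | no ¬pX = contradiction pX ¬pX

    weight-¬P : ∀ X → ¬ P X → weight X ≡ 0
    weight-¬P X ¬pX with P? X
    ... | yes pX = contradiction pX ¬pX
    ... | no _   = refl

  largest : ∃ P → ∃ λ L → P L × (∀ X → P X → ∣ X ∣ ≤ ∣ L ∣)
  largest (J , pJ) with maxSub-attained weight
  ... | L , max≡ = conclude (P? L)
    where
    conclude : Dec (P L) → ∃ λ L → P L × (∀ X → P X → ∣ X ∣ ≤ ∣ L ∣)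
    conclude (yes pL) = L , pL , λ X pX →
      s≤s⁻¹ (subst₂ _≤_ (weight-P X pX) (trans max≡ (weight-P L pL)) (maxSub-upper weight X))
    conclude (no ¬pL) = contradiction
      (subst₂ _≤_ (weight-P J pJ) (trans max≡ (weight-¬P L ¬pL)) (maxSub-upper weight J)) λ ()

⊆-card-≡ : ∀ {n} {p q : Subset n} → p ⊆ q → ∣ q ∣ ≤ ∣ p ∣ → p ≡ q
⊆-card-≡ {p = p} {q} p⊆q ∣q∣≤∣p∣ = ⊆-antisym p⊆q q⊆p
  where
  q⊆p : q ⊆ p
  q⊆p {x} x∈q with x ∈? p
  ... | yes x∈p = x∈p
  ... | no x∉p  = contradiction ∣q∣≤∣p∣ (<⇒≱ (p⊂q⇒∣p∣<∣q∣ (p⊆q , x , x∈q , x∉p)))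

∣p∪q∣≤∣p∣+∣q∣ : ∀ {n} (p q : Subset n) → ∣ p ∪ q ∣ ≤ ∣ p ∣ + ∣ q ∣
∣p∪q∣≤∣p∣+∣q∣ []            []            = z≤n
∣p∪q∣≤∣p∣+∣q∣ (outside ∷ p) (outside ∷ q) = ∣p∪q∣≤∣p∣+∣q∣ p q
∣p∪q∣≤∣p∣+∣q∣ (outside ∷ p) (inside ∷ q)  =
  subst (suc ∣ p ∪ q ∣ ≤_) (sym (+-suc ∣ p ∣ ∣ q ∣)) (s≤s (∣p∪q∣≤∣p∣+∣q∣ p q))
∣p∪q∣≤∣p∣+∣q∣ (inside ∷ p)  (outside ∷ q) = s≤s (∣p∪q∣≤∣p∣+∣q∣ p q)
∣p∪q∣≤∣p∣+∣q∣ (inside ∷ p)  (inside ∷ q)  =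
  s≤s (≤-trans (∣p∪q∣≤∣p∣+∣q∣ p q) (+-monoʳ-≤ ∣ p ∣ (n≤1+n _)))

∣⁅x⁆∪p∣≡1+∣p∣ : ∀ {n} (x : Fin n) (p : Subset n) → x ∉ p → ∣ ⁅ x ⁆ ∪ p ∣ ≡ suc ∣ p ∣
∣⁅x⁆∪p∣≡1+∣p∣ zero    (inside ∷ p)  x∉p = contradiction here x∉p
∣⁅x⁆∪p∣≡1+∣p∣ zero    (outside ∷ p) x∉p = cong (λ q → suc ∣ q ∣) (∪-identityˡ p)
∣⁅x⁆∪p∣≡1+∣p∣ (suc x) (inside ∷ p)  x∉p = cong suc (∣⁅x⁆∪p∣≡1+∣p∣ x p (λ x∈p → x∉p (there x∈p)))
∣⁅x⁆∪p∣≡1+∣p∣ (suc x) (outside ∷ p) x∉p = ∣⁅x⁆∪p∣≡1+∣p∣ x p (λ x∈p → x∉p (there x∈p))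

x∈p⇒⁅x⁆⊆p : ∀ {n} {x : Fin n} {p : Subset n} → x ∈ p → ⁅ x ⁆ ⊆ p
x∈p⇒⁅x⁆⊆p {x = x} {p} x∈p y∈⁅x⁆ = subst (_∈ p) (sym (x∈⁅y⁆⇒x≡y x y∈⁅x⁆)) x∈p

∪-least : ∀ {n} {p q r : Subset n} → p ⊆ r → q ⊆ r → p ∪ q ⊆ r
∪-least {p = p} {q} p⊆r q⊆r x∈p∪q with x∈p∪q⁻ p q x∈p∪q
... | inj₁ x∈p = p⊆r x∈p
... | inj₂ x∈q = q⊆r x∈q

++-split : ∀ s {t} (Z : Subset (s + t)) → ∃₂ λ X Y → Z ≡ X ++ Y
++-split s Z = take s Z , drop s Z , sym (take++drop≡id s Z)

take-++ : ∀ {s t} (X : Subset s) (Y : Subset t) → take s (X ++ Y) ≡ X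
take-++ []      Y = refl
take-++ (x ∷ X) Y = cong (x ∷_) (take-++ X Y)

drop-++ : ∀ {s t} (X : Subset s) (Y : Subset t) → drop s (X ++ Y) ≡ Y
drop-++ []      Y = refl
drop-++ (x ∷ X) Y = drop-++ X Y

∣++∣ : ∀ {s t} (X : Subset s) (Y : Subset t) → ∣ X ++ Y ∣ ≡ ∣ X ∣ + ∣ Y ∣
∣++∣ []            Y = refl
∣++∣ (inside ∷ X)  Y = cong suc (∣++∣ X Y)
∣++∣ (outside ∷ X) Y = ∣++∣ X Y

∣⊥++∣ : ∀ {s t} (Y : Subset t) → ∣ ⊥ {s} ++ Y ∣ ≡ ∣ Y ∣
∣⊥++∣ {s} Y = trans (∣++∣ (⊥ {s}) Y) (cong (_+ ∣ Y ∣) (∣⊥∣≡0 s))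

∪-++ : ∀ {s t} (X X' : Subset s) (Y Y' : Subset t) →
       (X ++ Y) ∪ (X' ++ Y') ≡ (X ∪ X') ++ (Y ∪ Y')
∪-++ []      []       Y Y' = refl
∪-++ (x ∷ X) (x' ∷ X') Y Y' = cong (_ ∷_) (∪-++ X X' Y Y')

⊤-++ : ∀ s t → ⊤ {s + t} ≡ ⊤ {s} ++ ⊤ {t}
⊤-++ zero    t = refl
⊤-++ (suc s) t = cong (inside ∷_) (⊤-++ s t)

∁-Tset : ∀ s t → ∁ (Tset s t) ≡ ⊤ {s} ++ ⊥ {t}
∁-Tset s t = trans (map-++ not (⊥ {s}) (⊤ {t}))
                   (cong₂ _++_ (map-replicate not outside s) (map-replicate not inside t))

++-⊆ : ∀ {s t} {X X' : Subset s} {Y Y' : Subset t} → X ⊆ X' → Y ⊆ Y' → X ++ Y ⊆ X' ++ Y'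
++-⊆ {X = []}    {[]}     X⊆X' Y⊆Y' x∈       = Y⊆Y' x∈
++-⊆ {X = x ∷ X} {x' ∷ X'} X⊆X' Y⊆Y' here with X⊆X' here
... | here = here
++-⊆ {X = x ∷ X} {x' ∷ X'} X⊆X' Y⊆Y' (there x∈) = there (++-⊆ (drop-∷-⊆ X⊆X') Y⊆Y' x∈)

++-⊆ˡ : ∀ {s t} {X X' : Subset s} {Y Y' : Subset t} → X ++ Y ⊆ X' ++ Y' → X ⊆ X'
++-⊆ˡ {X = x ∷ X} {x' ∷ X'} ⊆' here with ⊆' here
... | here = here
++-⊆ˡ {X = x ∷ X} {x' ∷ X'} ⊆' (there x∈) = there (++-⊆ˡ (drop-∷-⊆ ⊆') x∈)

++-⊆ʳ : ∀ {s t} {X X' : Subset s} {Y Y' : Subset t} → X ++ Y ⊆ X' ++ Y' → Y ⊆ Y'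
++-⊆ʳ {X = []}    {[]}     ⊆' = ⊆'
++-⊆ʳ {X = x ∷ X} {x' ∷ X'} ⊆' = ++-⊆ʳ (drop-∷-⊆ ⊆')

-- Ranks of independence systems

module _ {n} (K : IndepSystem n) where

  rank-≥ : ∀ {X I} → I ⊆ X → Indep K I → ∣ I ∣ ≤ rank K X
  rank-≥ {X} {I} I⊆X iI = subst (_≤ rank K X) value (maxSub-upper _ I)
    where
    value : (if does (I ⊆? X) ∧ does (indep? K I) then ∣ I ∣ else 0) ≡ ∣ I ∣
    value with I ⊆? X | indep? K I
    ... | yes _    | yes _   = refl
    ... | no I⊈X   | _       = contradiction (λ {x} → I⊆X {x}) I⊈X
    ... | yes _    | no ¬iI  = contradiction iI ¬iI

  rank-≤ : ∀ {X k} → (∀ I → I ⊆ X → Indep K I → ∣ I ∣ ≤ k) → rank K X ≤ k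
  rank-≤ {X} {k} bound = maxSub-least _ candidate
    where
    candidate : ∀ I → (if does (I ⊆? X) ∧ does (indep? K I) then ∣ I ∣ else 0) ≤ k
    candidate I with I ⊆? X | indep? K I
    ... | yes I⊆X | yes iI = bound I I⊆X iI
    ... | no _    | _      = z≤n
    ... | yes _   | no _   = z≤n

  rank-mono : ∀ {X Y} → X ⊆ Y → rank K X ≤ rank K Y
  rank-mono X⊆Y = rank-≤ (λ I I⊆X iI → rank-≥ (⊆-trans I⊆X X⊆Y) iI)

  rank≤card : ∀ X → rank K X ≤ ∣ X ∣
  rank≤card X = rank-≤ (λ I I⊆X _ → p⊆q⇒∣p∣≤∣q∣ I⊆X)

  rank-⊥ : rank K ⊥ ≡ 0
  rank-⊥ = n≤0⇒n≡0 (subst (rank K ⊥ ≤_) (∣⊥∣≡0 n) (rank≤card ⊥))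

rank-cong : ∀ {n} {K L : IndepSystem n} → K ≐ L → ∀ X → rank K X ≡ rank L X
rank-cong {K = K} {L} K≐L X = ≤-antisym
  (rank-≤ K (λ I I⊆X iI → rank-≥ L I⊆X (proj₁ (K≐L I) iI)))
  (rank-≤ L (λ I I⊆X iI → rank-≥ K I⊆X (proj₂ (K≐L I) iI)))

separator-cong : ∀ {n} {K L : IndepSystem n} → K ≐ L → ∀ X → IsSeparator L X → IsSeparator K X
separator-cong {K = K} {L} K≐L X sep =
  trans (cong₂ _+_ (≐-rank X) (≐-rank (∁ X))) (trans sep (sym (≐-rank ⊤)))
  where
  ≐-rank : ∀ Y → rank K Y ≡ rank L Y
  ≐-rank = rank-cong {K = K} {L} K≐L

-- Matroids: rank, loops, coloops and bases

module _ {n} (M : Matroid n) where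

  rank-attained : ∀ X → ∃ λ I → I ⊆ X × Ind M I × rk M X ≡ ∣ I ∣
  rank-attained X
    with maxSub-attained (λ I → if does (I ⊆? X) ∧ does (indep? (system M) I) then ∣ I ∣ else 0)
  ... | I , max≡ with I ⊆? X | indep? (system M) I
  ...   | yes I⊆X | yes iI = I , I⊆X , iI , max≡
  ...   | no _    | _      = ⊥ , ⊥⊆ , indep-∅ M , trans max≡ (sym (∣⊥∣≡0 n))
  ...   | yes _   | no _   = ⊥ , ⊥⊆ , indep-∅ M , trans max≡ (sym (∣⊥∣≡0 n))

  rank≥card⇒indep : ∀ {X} → ∣ X ∣ ≤ rk M X → Ind M X
  rank≥card⇒indep {X} ∣X∣≤r with rank-attained X
  ... | I , I⊆X , iI , r≡ = subst (Ind M) (⊆-card-≡ I⊆X (subst (∣ X ∣ ≤_) r≡ ∣X∣≤r)) iI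

  indep⇒rank≡card : ∀ {X} → Ind M X → rk M X ≡ ∣ X ∣
  indep⇒rank≡card {X} iX = ≤-antisym (rank≤card (system M) X) (rank-≥ (system M) ⊆-refl iX)

  nonLoop⇒rank≥1 : ∀ {a A} → a ∈ A → Ind M ⁅ a ⁆ → 1 ≤ rk M A
  nonLoop⇒rank≥1 {a} {A} a∈A ia = subst (_≤ rk M A) (∣⁅x⁆∣≡1 a) (rank-≥ (system M) (x∈p⇒⁅x⁆⊆p a∈A) ia)

  -- independent sets avoid loops, so adding loops does not raise the rank
  rank-∪-loops : ∀ {A} → (∀ a → a ∈ A → IsLoop M a) → ∀ X → rk M (X ∪ A) ≤ rk M X
  rank-∪-loops {A} loops X = rank-≤ (system M) λ I I⊆X∪A iI → rank-≥ (system M) (I⊆X I⊆X∪A iI) iI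
    where
    I⊆X : ∀ {I} → I ⊆ X ∪ A → Ind M I → I ⊆ X
    I⊆X {I} I⊆X∪A iI {x} x∈I with x∈p∪q⁻ X A (I⊆X∪A x∈I)
    ... | inj₁ x∈X = x∈X
    ... | inj₂ x∈A = contradiction (indep-⊆ M (x∈p⇒⁅x⁆⊆p x∈I) iI) (loops x x∈A)

  -- every independent set extends to a basis (a largest independent superset)
  basis-extension : ∀ {J} → Ind M J → ∃ λ B → IsBasis M B × J ⊆ B
  basis-extension {J} iJ with largest (λ L → (J ⊆? L) ×-dec indep? (system M) L) (J , ⊆-refl , iJ)
  ... | B , (J⊆B , iB) , maximum =
    B , (iB , λ B' iB' B⊆B' → sym (⊆-card-≡ B⊆B' (maximum B' (⊆-trans J⊆B B⊆B' , iB')))) , J⊆B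

  basis-largest : ∀ {B Y} → IsBasis M B → Ind M Y → ∣ Y ∣ ≤ ∣ B ∣
  basis-largest {B} {Y} (iB , maximal) iY with ∣ Y ∣ ≤? ∣ B ∣
  ... | yes ∣Y∣≤∣B∣ = ∣Y∣≤∣B∣
  ... | no ∣Y∣≰∣B∣ with indep-aug M iB iY (≰⇒> ∣Y∣≰∣B∣)
  ...   | e , _ , e∉B , iB∪e =
    contradiction (subst (e ∈_) (maximal _ iB∪e (p⊆p∪q _)) (q⊆p∪q B ⁅ e ⁆ (x∈⁅x⁆ e))) e∉B

  indep-∪-coloops : ∀ {C J} → (∀ c → c ∈ C → IsColoop M c) → Ind M J → Ind M (C ∪ J)
  indep-∪-coloops coloops iJ with basis-extension iJ
  ... | B , basis , J⊆B = indep-⊆ M (∪-least (λ c∈C → coloops _ c∈C B basis) J⊆B) (proj₁ basis)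

-- Direct sums

module _ {s t} (M : Matroid s) (N : Matroid t) where

  directSum-indep⁺ : ∀ {X Y} → Ind M X → Ind N Y → Indep (directSum M N) (X ++ Y)
  directSum-indep⁺ {X} {Y} iX iY =
    subst (Ind M) (sym (take-++ X Y)) iX , subst (Ind N) (sym (drop-++ X Y)) iY

  directSum-indep⁻ : ∀ {X Y} → Indep (directSum M N) (X ++ Y) → Ind M X × Ind N Y
  directSum-indep⁻ {X} {Y} (iX , iY) =
    subst (Ind M) (take-++ X Y) iX , subst (Ind N) (drop-++ X Y) iY

  rank-directSum : ∀ X Y → rank (directSum M N) (X ++ Y) ≡ rk M X + rk N Y
  rank-directSum X Y = ≤-antisym upper lower
    where
    upper : rank (directSum M N) (X ++ Y) ≤ rk M X + rk N Y
    upper = rank-≤ (directSum M N) bound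
      where
      bound : ∀ Z → Z ⊆ X ++ Y → Indep (directSum M N) Z → ∣ Z ∣ ≤ rk M X + rk N Y
      bound Z Z⊆ iZ with ++-split s Z
      ... | X' , Y' , refl with directSum-indep⁻ {X'} {Y'} iZ
      ...   | iX' , iY' = subst (_≤ rk M X + rk N Y) (sym (∣++∣ X' Y'))
              (+-mono-≤ (rank-≥ (system M) (++-⊆ˡ {X = X'} {X} {Y'} {Y} Z⊆) iX')
                        (rank-≥ (system N) (++-⊆ʳ {X = X'} {X} {Y'} {Y} Z⊆) iY'))
    lower : rk M X + rk N Y ≤ rank (directSum M N) (X ++ Y)
    lower with rank-attained M X | rank-attained N Y
    ... | I , I⊆X , iI , rI | J , J⊆Y , iJ , rJ =
      subst (_≤ rank (directSum M N) (X ++ Y)) (trans (∣++∣ I J) (sym (cong₂ _+_ rI rJ)))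
        (rank-≥ (directSum M N) (++-⊆ I⊆X J⊆Y) (directSum-indep⁺ iI iJ))

  directSum-separator : IsSeparator (directSum M N) (Tset s t)
  directSum-separator = begin
      r (⊥ {s} ++ ⊤ {t}) + r (∁ (Tset s t))
    ≡⟨ cong (λ Z → r (⊥ {s} ++ ⊤ {t}) + r Z) (∁-Tset s t) ⟩
      r (⊥ {s} ++ ⊤ {t}) + r (⊤ {s} ++ ⊥ {t})
    ≡⟨ cong₂ _+_ (rank-directSum ⊥ ⊤) (rank-directSum ⊤ ⊥) ⟩
      (rk M ⊥ + rk N ⊤) + (rk M ⊤ + rk N ⊥)
    ≡⟨ cong₂ (λ a b → (a + rk N ⊤) + (rk M ⊤ + b)) (rank-⊥ (system M)) (rank-⊥ (system N)) ⟩
      rk N ⊤ + (rk M ⊤ + 0)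
    ≡⟨ trans (cong (rk N ⊤ +_) (+-identityʳ (rk M ⊤))) (+-comm (rk N ⊤) (rk M ⊤)) ⟩
      rk M ⊤ + rk N ⊤
    ≡⟨ sym (rank-directSum ⊤ ⊤) ⟩
      r (⊤ {s} ++ ⊤ {t})
    ≡⟨ cong r (sym (⊤-++ s t)) ⟩
      r (⊤ {s + t})
    ∎
    where
    open ≡-Reasoning
    r : Subset (s + t) → ℕ
    r = rank (directSum M N)

-- The principal sum (M, N; A, B) = M⁺(A,B) ∨ N₀

module PrincipalSum {s t} (M : Matroid s) (N : Matroid t) (A : Subset s) (B : Subset t) where

  K : IndepSystem (s + t)
  K = principalSum M N A B

  D : IndepSystem (s + t)
  D = directSum M N

  LoopsOrColoops : Set
  LoopsOrColoops = (∀ a → a ∈ A → IsLoop M a) ⊎ (∀ b → b ∈ B → IsColoop N b)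

  rankPlus-++ : ∀ X Y → rankPlus M A B (X ++ Y) ≡ rk M (X ∪ A) ⊓ (rk M X + ∣ Y ∩ B ∣)
  rankPlus-++ X Y =
    cong₂ (λ X' Y' → rk M (X' ∪ A) ⊓ (rk M X' + ∣ Y' ∩ B ∣)) (take-++ X Y) (drop-++ X Y)

  plus-indep⁻ : ∀ X Y → Indep (MPlus M A B) (X ++ Y) →
                Ind M X × Y ⊆ B × ∣ X ∣ + ∣ Y ∣ ≤ rk M (X ∪ A)
  plus-indep⁻ X Y indep = rank≥card⇒indep M ∣X∣≤rX , Y⊆B , ≤first
    where
    r≡ : rk M (X ∪ A) ⊓ (rk M X + ∣ Y ∩ B ∣) ≡ ∣ X ∣ + ∣ Y ∣
    r≡ = trans (sym (rankPlus-++ X Y)) (trans indep (∣++∣ X Y))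
    ≤first : ∣ X ∣ + ∣ Y ∣ ≤ rk M (X ∪ A)
    ≤first = subst (_≤ rk M (X ∪ A)) r≡ (m⊓n≤m _ _)
    ≤second : ∣ X ∣ + ∣ Y ∣ ≤ rk M X + ∣ Y ∩ B ∣
    ≤second = subst (_≤ rk M X + ∣ Y ∩ B ∣) r≡ (m⊓n≤n _ _)
    -- as r_M(X) ≤ |X| and |Y ∩ B| ≤ |Y|, both summands of ≤second are tight
    ∣X∣≤rX : ∣ X ∣ ≤ rk M X
    ∣X∣≤rX = +-cancelʳ-≤ ∣ Y ∣ _ _
               (≤-trans ≤second (+-monoʳ-≤ (rk M X) (∣p∩q∣≤∣p∣ Y B)))
    ∣Y∣≤∣Y∩B∣ : ∣ Y ∣ ≤ ∣ Y ∩ B ∣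
    ∣Y∣≤∣Y∩B∣ = +-cancelˡ-≤ ∣ X ∣ _ _
                  (≤-trans ≤second (+-monoˡ-≤ ∣ Y ∩ B ∣ (rank≤card (system M) X)))
    Y⊆B : Y ⊆ B
    Y⊆B y∈Y = p∩q⊆q Y B (subst (_ ∈_) (sym (⊆-card-≡ (p∩q⊆p Y B) ∣Y∣≤∣Y∩B∣)) y∈Y)

  plus-indep-S : ∀ {X} → Ind M X → Indep (MPlus M A B) (X ++ ⊥ {t})
  plus-indep-S {X} iX = begin
      rankPlus M A B (X ++ ⊥)
    ≡⟨ rankPlus-++ X ⊥ ⟩
      rk M (X ∪ A) ⊓ (rk M X + ∣ ⊥ ∩ B ∣)
    ≡⟨ cong (λ k → rk M (X ∪ A) ⊓ (rk M X + k)) (trans (cong ∣_∣ (∩-zeroˡ B)) (∣⊥∣≡0 t)) ⟩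
      rk M (X ∪ A) ⊓ (rk M X + 0)
    ≡⟨ m≥n⇒m⊓n≡n (≤-trans (≤-reflexive (+-identityʳ _)) (rank-mono (system M) (p⊆p∪q A))) ⟩
      rk M X + 0
    ≡⟨ cong₂ _+_ (indep⇒rank≡card M iX) (sym (∣⊥∣≡0 t)) ⟩
      ∣ X ∣ + ∣ ⊥ {t} ∣
    ≡⟨ sym (∣++∣ X ⊥) ⟩
      ∣ X ++ ⊥ ∣
    ∎
    where open ≡-Reasoning

  plus-indep-b : 1 ≤ rk M A → ∀ {b} → b ∈ B → Indep (MPlus M A B) (⊥ {s} ++ ⁅ b ⁆)
  plus-indep-b 1≤rA {b} b∈B = begin
      rankPlus M A B (⊥ ++ ⁅ b ⁆)
    ≡⟨ rankPlus-++ ⊥ ⁅ b ⁆ ⟩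
      rk M (⊥ ∪ A) ⊓ (rk M ⊥ + ∣ ⁅ b ⁆ ∩ B ∣)
    ≡⟨ cong₂ (λ X k → rk M X ⊓ k) (∪-identityˡ A) (cong₂ _+_ (rank-⊥ (system M)) ∣⁅b⁆∩B∣≡1) ⟩
      rk M A ⊓ 1
    ≡⟨ m≥n⇒m⊓n≡n 1≤rA ⟩
      1
    ≡⟨ sym (trans (∣⊥++∣ {s} ⁅ b ⁆) (∣⁅x⁆∣≡1 b)) ⟩
      ∣ ⊥ {s} ++ ⁅ b ⁆ ∣
    ∎
    where
    open ≡-Reasoning
    ∣⁅b⁆∩B∣≡1 : ∣ ⁅ b ⁆ ∩ B ∣ ≡ 1
    ∣⁅b⁆∩B∣≡1 = trans (cong ∣_∣ (⊆-antisym (p∩q⊆p _ _) (λ x∈⁅b⁆ → x∈p∩q⁺ (x∈⁅b⁆ , x∈p⇒⁅x⁆⊆p b∈B x∈⁅b⁆))))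
                      (∣⁅x⁆∣≡1 b)

  N₀-indep⁺ : ∀ {Y} → Ind N Y → Indep (N₀ {s} N) (⊥ {s} ++ Y)
  N₀-indep⁺ {Y} iY = take-++ (⊥ {s}) Y , subst (Ind N) (sym (drop-++ (⊥ {s}) Y)) iY

  N₀-indep⁻ : ∀ {X Y} → Indep (N₀ {s} N) (X ++ Y) → X ≡ ⊥ × Ind N Y
  N₀-indep⁻ {X} {Y} (X≡⊥ , iY) = trans (sym (take-++ X Y)) X≡⊥ , subst (Ind N) (drop-++ X Y) iY

  sum-indep⁺ : ∀ {X Y Y'} → Indep (MPlus M A B) (X ++ Y) → Ind N Y' → Indep K (X ++ (Y ∪ Y'))
  sum-indep⁺ {X} {Y} {Y'} iXY iY' =
    X ++ Y , ⊥ ++ Y' , iXY , N₀-indep⁺ iY' ,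
    trans (cong (_++ (Y ∪ Y')) (sym (∪-identityʳ X))) (sym (∪-++ X ⊥ Y Y'))

  sum-indep⁻ : ∀ {Z} → Indep K Z → ∃ λ X → ∃ λ Y → ∃ λ Y' →
               Z ≡ X ++ (Y ∪ Y') × Indep (MPlus M A B) (X ++ Y) × Ind N Y'
  sum-indep⁻ (I , J , iI , iJ , refl) with ++-split s I | ++-split s J
  ... | X , Y , refl | X' , Y' , refl with N₀-indep⁻ {X'} {Y'} iJ
  ...   | refl , iY' =
    X , Y , Y' , trans (∪-++ X ⊥ Y Y') (cong (_++ (Y ∪ Y')) (∪-identityʳ X)) , iI , iY'

  directSum⊆principalSum : ∀ {X Y} → Ind M X → Ind N Y → Indep K (X ++ Y)
  directSum⊆principalSum {X} {Y} iX iY =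
    subst (λ W → Indep K (X ++ W)) (∪-identityˡ Y) (sum-indep⁺ {X} {⊥} {Y} (plus-indep-S iX) iY)

  loopsOrColoops⇒directSum : LoopsOrColoops → K ≐ D
  loopsOrColoops⇒directSum condition Z = principal⇒direct , direct⇒principal
    where
    principal⇒direct : Indep K Z → Indep D Z
    principal⇒direct iZ with sum-indep⁻ iZ
    ... | X , Y , Y' , refl , iXY , iY' with plus-indep⁻ X Y iXY
    ...   | iX , Y⊆B , ∣X∣+∣Y∣≤rXA = directSum-indep⁺ M N iX (T-part condition)
      where
      T-part : LoopsOrColoops → Ind N (Y ∪ Y')
      T-part (inj₁ loops) =
        subst (λ W → Ind N (W ∪ Y')) (⊆-card-≡ ⊥⊆ ∣Y∣≤∣⊥∣) (subst (Ind N) (sym (∪-identityˡ Y')) iY')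
        where
        -- |X| + |Y| ≤ r_M(X ∪ A) = r_M(X) ≤ |X| forces Y = ∅
        ∣X∣+∣Y∣≤∣X∣+0 : ∣ X ∣ + ∣ Y ∣ ≤ ∣ X ∣ + 0
        ∣X∣+∣Y∣≤∣X∣+0 = begin
          ∣ X ∣ + ∣ Y ∣  ≤⟨ ∣X∣+∣Y∣≤rXA ⟩
          rk M (X ∪ A)  ≤⟨ rank-∪-loops M loops X ⟩
          rk M X        ≤⟨ rank≤card (system M) X ⟩
          ∣ X ∣         ≡⟨ +-identityʳ ∣ X ∣ ⟨
          ∣ X ∣ + 0     ∎
          where open ≤-Reasoning
        ∣Y∣≤∣⊥∣ : ∣ Y ∣ ≤ ∣ ⊥ {t} ∣
        ∣Y∣≤∣⊥∣ = subst (∣ Y ∣ ≤_) (sym (∣⊥∣≡0 t)) (+-cancelˡ-≤ ∣ X ∣ _ _ ∣X∣+∣Y∣≤∣X∣+0)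
      T-part (inj₂ coloops) = indep-∪-coloops N (λ y y∈Y → coloops y (Y⊆B y∈Y)) iY'
    direct⇒principal : Indep D Z → Indep K Z
    direct⇒principal iZ with ++-split s Z
    ... | X , Y , refl with directSum-indep⁻ M N {X} {Y} iZ
    ...   | iX , iY = directSum⊆principalSum iX iY

  directSum⇒separator : K ≐ D → IsSeparator K (Tset s t)
  directSum⇒separator K≐D = separator-cong {K = K} {D} K≐D (Tset s t) (directSum-separator M N)

  rank-M≤rank-S : rk M ⊤ ≤ rank K (∁ (Tset s t))
  rank-M≤rank-S with rank-attained M ⊤
  ... | I , _ , iI , r≡ = subst (_≤ rank K (∁ (Tset s t))) ∣I++⊥∣≡r
      (rank-≥ K (subst (I ++ ⊥ ⊆_) (sym (∁-Tset s t)) (++-⊆ {X = I} {⊤} {⊥ {t}} ⊆⊤ ⊆-refl))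
                (directSum⊆principalSum iI (indep-∅ N)))
    where
    ∣I++⊥∣≡r : ∣ I ++ ⊥ {t} ∣ ≡ rk M ⊤
    ∣I++⊥∣≡r = trans (∣++∣ I ⊥) (trans (cong (∣ I ∣ +_) (∣⊥∣≡0 t)) (trans (+-identityʳ _) (sym r≡)))

  rank-E≤ : ∀ {B'} → IsBasis N B' → rank K ⊤ ≤ rk M ⊤ + ∣ B' ∣
  rank-E≤ {B'} basis = rank-≤ K (λ Z _ iZ → bound iZ)
    where
    bound : ∀ {Z} → Indep K Z → ∣ Z ∣ ≤ rk M ⊤ + ∣ B' ∣
    bound iZ with sum-indep⁻ iZ
    ... | X , Y , Y' , refl , iXY , iY' with plus-indep⁻ X Y iXY
    ...   | _ , _ , ∣X∣+∣Y∣≤rXA = begin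
      ∣ X ++ (Y ∪ Y') ∣          ≡⟨ ∣++∣ X (Y ∪ Y') ⟩
      ∣ X ∣ + ∣ Y ∪ Y' ∣         ≤⟨ +-monoʳ-≤ ∣ X ∣ (∣p∪q∣≤∣p∣+∣q∣ Y Y') ⟩
      ∣ X ∣ + (∣ Y ∣ + ∣ Y' ∣)   ≡⟨ +-assoc ∣ X ∣ _ _ ⟨
      (∣ X ∣ + ∣ Y ∣) + ∣ Y' ∣   ≤⟨ +-mono-≤ (≤-trans ∣X∣+∣Y∣≤rXA (rank-mono (system M) ⊆⊤))
                                             (basis-largest N basis iY') ⟩
      rk M ⊤ + ∣ B' ∣            ∎
      where open ≤-Reasoning

  -- (1) ⇒ (3) when some element of A is not a loop: b ∉ B' for a basis B'
  -- would make {b} ∪ B' ⊆ T independent in K, contradicting rank counting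
  separator⇒coloops : IsSeparator K (Tset s t) → 1 ≤ rk M A → ∀ b → b ∈ B → IsColoop N b
  separator⇒coloops sep 1≤rA b b∈B B' basis with b ∈? B'
  ... | yes b∈B' = b∈B'
  ... | no b∉B'  = contradiction (begin-strict
      rk M ⊤ + ∣ B' ∣                              <⟨ +-monoʳ-< (rk M ⊤) (n<1+n ∣ B' ∣) ⟩
      rk M ⊤ + suc ∣ B' ∣                          ≤⟨ +-mono-≤ rank-M≤rank-S 1+∣B'∣≤rank-T ⟩
      rank K (∁ (Tset s t)) + rank K (Tset s t)    ≡⟨ +-comm (rank K (∁ (Tset s t))) _ ⟩
      rank K (Tset s t) + rank K (∁ (Tset s t))    ≡⟨ sep ⟩
      rank K ⊤                                     ≤⟨ rank-E≤ basis ⟩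
      rk M ⊤ + ∣ B' ∣                              ∎) (<-irrefl refl)
    where
    open ≤-Reasoning
    1+∣B'∣≤rank-T : suc ∣ B' ∣ ≤ rank K (Tset s t)
    1+∣B'∣≤rank-T =
      subst (_≤ rank K (Tset s t)) (trans (∣⊥++∣ {s} (⁅ b ⁆ ∪ B')) (∣⁅x⁆∪p∣≡1+∣p∣ b B' b∉B'))
        (rank-≥ K (++-⊆ {X = ⊥ {s}} ⊆-refl ⊆⊤)
                  (sum-indep⁺ {⊥} {⁅ b ⁆} {B'} (plus-indep-b 1≤rA b∈B) (proj₁ basis)))

  separator⇒loopsOrColoops : IsSeparator K (Tset s t) → LoopsOrColoops
  separator⇒loopsOrColoops sep with any? (λ a → (a ∈? A) ×-dec indep? (system M) ⁅ a ⁆)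
  ... | yes (a , a∈A , ia) = inj₂ (separator⇒coloops sep (nonLoop⇒rank≥1 M a∈A ia))
  ... | no noNonLoop       = inj₁ (λ a a∈A ia → noNonLoop (a , a∈A , ia))

lemma3p17 : ∀ {s t : ℕ} (M : Matroid s) (N : Matroid t) (A : Subset s) (B : Subset t) →
    (IsSeparator (principalSum M N A B) (Tset s t) → principalSum M N A B ≐ directSum M N)
    × (principalSum M N A B ≐ directSum M N →
         ((∀ a → a ∈ A → IsLoop M a) ⊎ (∀ b → b ∈ B → IsColoop N b)))
    × (((∀ a → a ∈ A → IsLoop M a) ⊎ (∀ b → b ∈ B → IsColoop N b)) →
         IsSeparator (principalSum M N A B) (Tset s t))
lemma3p17 M N A B =
    (λ sep → loopsOrColoops⇒directSum (separator⇒loopsOrColoops sep))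
  , (λ K≐D → separator⇒loopsOrColoops (directSum⇒separator K≐D))
  , (λ condition → directSum⇒separator (loopsOrColoops⇒directSum condition))
  where open PrincipalSum M N A B
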